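{- Let $\Sigma$ be an alphabet and $\emptyset\notin\Sigma$ a null character, and equip $\Sigma\cup\{\emptyset\}$ with the generalized Hamming metric ($d(a,b)=1$ for $a\ne b$). Then for any $x,y\in\Sigma^n$, $\operatorname{ed}_S(p(x),p(y))=2\operatorname{ed}(x,y)$.
   Context: $\operatorname{ed}(x,y)$ is the minimum number of insertions, deletions and substitutions (each of cost $1$) needed to transform $x$ into $y$. $\operatorname{ed}_S(u,v)$ (simple edit distance) is the minimum number of insertions and deletions only (each of cost $1$) needed to transform $u$ into $v$, where $\emptyset$ is treated as an ordinary character. The padded string of $x=x_1\cdots x_n$ is $p(x)=\emptyset x_1\emptyset x_2\emptyset\cdots\emptyset x_n\emptyset$. -}

module Defs where

open import Data.Nat using (ℕ; zero; suc; _≤_)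
open import Data.List using (List; []; _∷_; _++_)
open import Data.Maybe using (Maybe; just; nothing)
open import Data.Product using (_×_)
open import Relation.Binary.PropositionalEquality using (_≡_)

data InsDel {C : Set} : List C → List C → Set where
  ins : (u v : List C) (c : C) → InsDel (u ++ v) (u ++ (c ∷ v))
  del : (u v : List C) (c : C) → InsDel (u ++ (c ∷ v)) (u ++ v)

data Edit {C : Set} : List C → List C → Set where
  insdel : ∀ {x y} → InsDel x y → Edit x y
  sub : (u v : List C) (a b : C) → Edit (u ++ (a ∷ v)) (u ++ (b ∷ v))

data Steps {C : Set} (R : List C → List C → Set) : ℕ → List C → List C → Set where
  done : ∀ {x} → Steps R zero x x
  step : ∀ {k x y z} → R x y → Steps R k y z → Steps R (suc k) x z

IsMinSteps : {C : Set} → (List C → List C → Set) → List C → List C → ℕ → Set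
IsMinSteps R x y d = Steps R d x y × (∀ k → Steps R k x y → d ≤ k)

IsEd : {C : Set} → List C → List C → ℕ → Set
IsEd = IsMinSteps Edit

IsEdS : {C : Set} → List C → List C → ℕ → Set
IsEdS = IsMinSteps InsDel

-- Padded string over Σ ∪ {∅}, with ∅ represented by nothing:
-- p(x₁⋯xₙ) = ∅ x₁ ∅ x₂ ⋯ ∅ xₙ ∅
pad : {A : Set} → List A → List (Maybe A)
pad [] = nothing ∷ []
pad (a ∷ x) = nothing ∷ just a ∷ pad x

module Submission where

-- Every edit of x is realised by two insertions/deletions on p(x)
-- (insert ∅ then a; delete a then ∅; delete a then insert b), so an edit
-- chain of length d yields an ins/del chain of length 2d (padEdits).
--
-- An ins/del chain of length k from u to v leaves a common
-- subsequence (an alignment with L matches) satisfying |u| + |v| ≤ k + 2L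
-- (insDel⇒alignment).  Conversely, walking along an alignment of p(x) and
-- p(y) with L matches produces an edit chain x → y of length k' with
-- k' + L ≤ |x| + |y| + 1 (padAlignment⇒edits): a small automaton over the
-- two "phases" (at a gap ∅ / at a letter) of each padded word.  Combining,
-- 2d + 2L ≤ 2(k' + L) ≤ |p(x)| + |p(y)| ≤ k + 2L, whence 2d ≤ k.

open import Defs
open import Data.Nat using (ℕ; suc; _+_; _*_; _≤_; z≤n; s≤s)
open import Data.Nat.Properties
open import Data.Nat.Tactic.RingSolver using (solve-∀)
open import Data.List using (List; []; _∷_; _++_; length)
open import Data.List.Properties using (length-++-sucʳ)
open import Data.Maybe using (Maybe; just; nothing)
open import Data.Product using (Σ; _,_; _×_)
open import Relation.Binary.PropositionalEquality
  using (_≡_; refl; sym; trans; cong; cong₂; subst; subst₂)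

private
  variable
    A C : Set
    j k L B : ℕ
    u v w x y : List C

_▷_ : {R : List C → List C → Set} → Steps R j u v → Steps R k v w → Steps R (j + k) u w
done     ▷ t = t
step r s ▷ t = step r (s ▷ t)

infixr 5 _▷_

keepHeadSteps : (a : C) → Steps Edit k x y → Steps Edit k (a ∷ x) (a ∷ y)
keepHeadSteps a done = done
keepHeadSteps a (step (insdel (ins u v c)) s) = step (insdel (ins (a ∷ u) v c)) (keepHeadSteps a s)
keepHeadSteps a (step (insdel (del u v c)) s) = step (insdel (del (a ∷ u) v c)) (keepHeadSteps a s)
keepHeadSteps a (step (sub u v b c) s)        = step (sub (a ∷ u) v b c) (keepHeadSteps a s)

body : List A → List (Maybe A)
body []      = []
body (a ∷ x) = just a ∷ nothing ∷ body x

pad≡∅∷body : (x : List A) → pad x ≡ nothing ∷ body x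
pad≡∅∷body []      = refl
pad≡∅∷body (a ∷ x) = cong (λ t → nothing ∷ just a ∷ t) (pad≡∅∷body x)

body-++ : (x y : List A) → body (x ++ y) ≡ body x ++ body y
body-++ []      y = refl
body-++ (a ∷ x) y = cong (λ t → just a ∷ nothing ∷ t) (body-++ x y)

pad-++ : (x y : List A) → pad (x ++ y) ≡ (nothing ∷ body x) ++ body y
pad-++ x y = trans (pad≡∅∷body (x ++ y)) (cong (nothing ∷_) (body-++ x y))

length-pad : (x : List A) → length (pad x) ≡ suc (2 * length x)
length-pad []      = refl
length-pad (a ∷ x) = trans (cong (λ t → suc (suc t)) (length-pad x)) (twice-suc (length x))
  where
  twice-suc : ∀ m → suc (suc (suc (2 * m))) ≡ suc (2 * suc m)
  twice-suc = solve-∀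

padEdit : Edit x y → Steps InsDel 2 (pad x) (pad y)
padEdit (insdel (ins u v c)) =
  subst₂ (Steps InsDel 2) (sym (pad-++ u v)) (sym (pad-++ u (c ∷ v)))
    (step (ins (nothing ∷ body u) (body v) nothing)
    (step (ins (nothing ∷ body u) (nothing ∷ body v) (just c)) done))
padEdit (insdel (del u v c)) =
  subst₂ (Steps InsDel 2) (sym (pad-++ u (c ∷ v))) (sym (pad-++ u v))
    (step (del (nothing ∷ body u) (nothing ∷ body v) (just c))
    (step (del (nothing ∷ body u) (body v) nothing) done))
padEdit (sub u v a b) =
  subst₂ (Steps InsDel 2) (sym (pad-++ u (a ∷ v))) (sym (pad-++ u (b ∷ v)))
    (step (del (nothing ∷ body u) (nothing ∷ body v) (just a))
    (step (ins (nothing ∷ body u) (nothing ∷ body v) (just b)) done))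

padEdits : Steps Edit k x y → Steps InsDel (2 * k) (pad x) (pad y)
padEdits done = done
padEdits {k = suc k} {x = x} {y = y} (step e s) =
  subst (λ n → Steps InsDel n (pad x) (pad y)) (sym (twice-suc k)) (padEdit e ▷ padEdits s)
  where
  twice-suc : ∀ m → 2 * suc m ≡ 2 + 2 * m
  twice-suc = solve-∀

data Align {C : Set} : List C → List C → ℕ → Set where
  nil   : Align [] [] 0
  match : (c : C) → Align u v L → Align (c ∷ u) (c ∷ v) (suc L)
  skipL : (c : C) → Align u v L → Align (c ∷ u) v L
  skipR : (c : C) → Align u v L → Align u (c ∷ v) L

alignSelf : (u : List C) → Align u u (length u)
alignSelf []      = nil
alignSelf (c ∷ u) = match c (alignSelf u)

align-[]ˡ : Align [] v L → L ≡ 0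
align-[]ˡ nil         = refl
align-[]ˡ (skipR c a) = align-[]ˡ a

align-[]ʳ : Align u [] L → L ≡ 0
align-[]ʳ nil         = refl
align-[]ʳ (skipL c a) = align-[]ʳ a

align-insert : (u : List C) (c : C) → Align (u ++ v) w L → Align (u ++ c ∷ v) w L
align-insert []      c al            = skipL c al
align-insert (x ∷ u) c (match .x al) = match x (align-insert u c al)
align-insert (x ∷ u) c (skipL .x al) = skipL x (align-insert u c al)
align-insert (x ∷ u) c (skipR d al)  = skipR d (align-insert (x ∷ u) c al)

align-delete : (u : List C) (c : C) → Align (u ++ c ∷ v) w L →
               Σ ℕ λ L' → Align (u ++ v) w L' × L ≤ suc L'
align-delete []      c (match {L = L} .c al) = L , skipR c al , ≤-refl
align-delete []      c (skipL {L = L} .c al) = L , al , n≤1+n L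
align-delete (x ∷ u) c (match .x al) with align-delete u c al
... | L' , al' , le = suc L' , match x al' , s≤s le
align-delete (x ∷ u) c (skipL .x al) with align-delete u c al
... | L' , al' , le = L' , skipL x al' , le
align-delete u c (skipR d al) with align-delete u c al
... | L' , al' , le = L' , skipR d al' , le

insDel⇒alignment : Steps InsDel k u v →
                   Σ ℕ λ L → Align u v L × length u + length v ≤ k + (L + L)
insDel⇒alignment {u = u} done = length u , alignSelf u , ≤-refl
insDel⇒alignment {k = suc k} {v = w} (step (del u v c) s) with insDel⇒alignment s
... | L , al , le = L , align-insert u c al ,
      subst (λ n → n ≤ suc k + (L + L)) (cong (_+ length w) (sym (length-++-sucʳ u c v))) (s≤s le)
insDel⇒alignment {k = suc k} {v = w} (step (ins u v c) s) with insDel⇒alignment s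
... | L , al , le with align-delete u c al
... | L' , al' , le' = L' , al' , +-cancelˡ-≤ 1 _ _ (begin
      suc (length (u ++ v) + length w)  ≡⟨ cong (_+ length w) (sym (length-++-sucʳ u c v)) ⟩
      length (u ++ c ∷ v) + length w    ≤⟨ le ⟩
      k + (L + L)                       ≤⟨ +-monoʳ-≤ k (+-mono-≤ le' le') ⟩
      k + (suc L' + suc L')             ≡⟨ two-more k L' ⟩
      suc (suc k + (L' + L'))           ∎)
  where
  open ≤-Reasoning
  two-more : ∀ k m → k + (suc m + suc m) ≡ suc (suc k + (m + m))
  two-more = solve-∀

Repair : List C → List C → ℕ → ℕ → Set
Repair x y L B = Σ ℕ λ k → Steps Edit k x y × k + L ≤ B

relax : {B' : ℕ} → B ≤ B' → Repair x y L B → Repair x y L B'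
relax B≤B' (k , s , le) = k , s , ≤-trans le B≤B'

rebudget : (m n : ℕ) → Repair x y L (suc (suc (m + n))) → Repair x y L (suc (m + suc n))
rebudget m n = relax (≤-reflexive (cong suc (sym (+-suc m n))))

countMatch : Repair x y L B → Repair x y (suc L) (suc B)
countMatch {B = B} (k , s , le) = k , s , subst (_≤ suc B) (sym (+-suc k _)) (s≤s le)

keepHead : (a : C) → Repair x y L B → Repair (a ∷ x) (a ∷ y) L B
keepHead a (k , s , le) = k , keepHeadSteps a s , le

deleteHead : (a : C) → Repair x y L B → Repair (a ∷ x) y L (suc B)
deleteHead a (k , s , le) = suc k , step (insdel (del [] _ a)) s , s≤s le

insertHead : (b : C) → Repair x y L B → Repair x (b ∷ y) L (suc B)
insertHead b (k , s , le) = suc k , step (insdel (ins [] _ b)) (keepHeadSteps b s) , s≤s le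

substHead : (a b : C) → Repair x y L B → Repair (a ∷ x) (b ∷ y) L (suc B)
substHead a b (k , s , le) = suc k , step (sub [] _ a b) (keepHeadSteps b s) , s≤s le

deleteAll : (x : List C) → Repair x [] 0 (length x)
deleteAll []      = 0 , done , z≤n
deleteAll (a ∷ x) = deleteHead a (deleteAll x)

insertAll : (y : List C) → Repair [] y 0 (length y)
insertAll []      = 0 , done , z≤n
insertAll (b ∷ y) = insertHead b (insertAll y)

-- When both
-- are at a letter and one letter is skipped, we look one position further:
-- if the other letter is skipped too, the two skips become a substitution.
mutual
  fromGaps : (x y : List A) → Align (nothing ∷ body x) (nothing ∷ body y) L →
             Repair x y L (suc (length x + length y))
  fromGaps x y (match .nothing al) = countMatch (fromLetters x y al)
  fromGaps x y (skipL .nothing al) = fromLetterGap x y al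
  fromGaps x y (skipR .nothing al) = fromGapLetter x y al

  fromLetterGap : (x y : List A) → Align (body x) (nothing ∷ body y) L →
                  Repair x y L (suc (length x + length y))
  fromLetterGap []      y al rewrite align-[]ˡ al = relax (n≤1+n _) (insertAll y)
  fromLetterGap (a ∷ x) y (skipL .(just a) al)   = deleteHead a (fromGaps x y al)
  fromLetterGap (a ∷ x) y (skipR .nothing al)    = relax (n≤1+n _) (fromLetters (a ∷ x) y al)

  fromGapLetter : (x y : List A) → Align (nothing ∷ body x) (body y) L →
                  Repair x y L (suc (length x + length y))
  fromGapLetter x []      al rewrite align-[]ʳ al =
    relax (m≤n⇒m≤1+n (m≤m+n (length x) 0)) (deleteAll x)
  fromGapLetter x (b ∷ y) (skipR .(just b) al) = rebudget (length x) (length y) (insertHead b (fromGaps x y al))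
  fromGapLetter x (b ∷ y) (skipL .nothing al)  = relax (n≤1+n _) (fromLetters x (b ∷ y) al)

  fromLetters : (x y : List A) → Align (body x) (body y) L → Repair x y L (length x + length y)
  fromLetters []      y       al rewrite align-[]ˡ al = insertAll y
  fromLetters (a ∷ x) []      al rewrite align-[]ʳ al = relax (m≤m+n _ 0) (deleteAll (a ∷ x))
  fromLetters (a ∷ x) (.a ∷ y) (match .(just a) al) =
    rebudget (length x) (length y) (keepHead a (countMatch (fromGaps x y al)))
  fromLetters (a ∷ x) (b ∷ y) (skipL .(just a) (skipL .nothing al)) =
    deleteHead a (fromLetters x (b ∷ y) al)
  fromLetters (a ∷ x) (b ∷ y) (skipL .(just a) (skipR .(just b) al)) =
    rebudget (length x) (length y) (substHead a b (fromGaps x y al))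
  fromLetters (a ∷ x) (b ∷ y) (skipR .(just b) (skipR .nothing al)) =
    rebudget (length x) (length y) (insertHead b (fromLetters (a ∷ x) y al))
  fromLetters (a ∷ x) (b ∷ y) (skipR .(just b) (skipL .(just a) al)) =
    rebudget (length x) (length y) (substHead a b (fromGaps x y al))

padAlignment⇒edits : (x y : List A) → Align (pad x) (pad y) L →
                     Repair x y L (suc (length x + length y))
padAlignment⇒edits {L = L} x y al =
  fromGaps x y (subst₂ (λ u v → Align u v L) (pad≡∅∷body x) (pad≡∅∷body y) al)

padded-lower-bound : {d : ℕ} (x y : List A) → IsEd x y d →
                     Steps InsDel k (pad x) (pad y) → 2 * d ≤ k
padded-lower-bound {k = k} {d = d} x y (_ , minimal) s with insDel⇒alignment s
... | L , al , |px|+|py|≤k+2L with padAlignment⇒edits x y al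
... | k' , edits , k'+L≤ = +-cancelʳ-≤ (L + L) (2 * d) k (begin
  2 * d + (L + L)                        ≤⟨ +-monoˡ-≤ (L + L) (*-monoʳ-≤ 2 (minimal k' edits)) ⟩
  2 * k' + (L + L)                       ≡⟨ double-+ k' L ⟩
  2 * (k' + L)                           ≤⟨ *-monoʳ-≤ 2 k'+L≤ ⟩
  2 * suc (length x + length y)          ≡⟨ double-suc-+ (length x) (length y) ⟩
  suc (2 * length x) + suc (2 * length y) ≡⟨ sym (cong₂ _+_ (length-pad x) (length-pad y)) ⟩
  length (pad x) + length (pad y)        ≤⟨ |px|+|py|≤k+2L ⟩
  k + (L + L)                            ∎)
  where
  open ≤-Reasoning
  double-+ : ∀ a b → 2 * a + (b + b) ≡ 2 * (a + b)
  double-+ = solve-∀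
  double-suc-+ : ∀ a b → 2 * suc (a + b) ≡ suc (2 * a) + suc (2 * b)
  double-suc-+ = solve-∀

mainTheorem10 : {Σ : Set} (n : ℕ) (x y : List Σ) → length x ≡ n → length y ≡ n →
    (d : ℕ) → IsEd x y d → IsEdS (pad x) (pad y) (2 * d)
mainTheorem10 _ x y _ _ d ed@(optimal , _) =
  padEdits optimal , λ _ s → padded-lower-bound x y ed s
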